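{- Let $G$ be the subgraph of $Q_5$ (with vertices written as binary strings $x_1x_2x_3x_4x_5$) whose edge set consists of the following $20$ edges: (1) all edges of $Q_5$ joining two vertices with $x_4=x_5=0$, except those joining two vertices with $x_2=x_4=x_5=0$; (2) the edges $\langle 01010,01110\rangle$ and $\langle 11010,11110\rangle$; (3) the edges $\langle 01101,11101\rangle$ and $\langle 01001,11001\rangle$; (4) the $4$ edges $\langle x, x\,\Delta\,\{4\}\rangle$ for the vertices $x$ with $x_2=1$, $x_4=x_5=0$; (5) the $4$ edges $\langle x, x\,\Delta\,\{5\}\rangle$ for the vertices $x$ with $x_2=1$, $x_4=x_5=0$. Then $G$ divides $Q_5$. In fact, $E(G)$ is a fundamental set for $Q_5$.
   Context: $Q_5$ is the $5$-dimensional hypercube, with vertices identified with binary strings of length $5$ (equivalently subsets of $\{1,\ldots,5\}$), two vertices adjacent iff they differ in exactly one coordinate; $x\,\Delta\,\{i\}$ denotes the vertex obtained by flipping coordinate $i$. If $H$ is isomorphic to a subgraph of $G'$, $H$ divides $G'$ if there exist embeddings $\theta_1,\ldots,\theta_r$ of $H$ into $G'$ such that $\{E(\theta_1(H)),\ldots,E(\theta_r(H))\}$ is a partition of $E(G')$. A fundamental set of edges of a graph $G'$ is a subset of $E(G')$ whose translates under some subgroup of $\mathrm{Aut}(G')$ partition $E(G')$. -}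

module Defs where

open import Data.Bool using (Bool; true; false; not)
open import Data.Nat using (ℕ)
open import Data.Fin using (Fin; zero; suc)
open import Data.Vec using (Vec; []; _∷_; lookup; _[_]%=_)
open import Data.Product using (Σ; _×_; ∃)
open import Data.Sum using (_⊎_)
open import Relation.Nullary using (¬_)
open import Relation.Binary.PropositionalEquality using (_≡_)

-- Vertices of Q₅: binary strings x₁x₂x₃x₄x₅, stored as a Vec with
-- position i₁ = zero holding x₁, ..., i₅ holding x₅.
Vertex : Set
Vertex = Vec Bool 5

i1 i2 i3 i4 i5 : Fin 5
i1 = zero
i2 = suc zero
i3 = suc (suc zero)
i4 = suc (suc (suc zero))
i5 = suc (suc (suc (suc zero)))

flipAt : Fin 5 → Vertex → Vertex
flipAt i x = x [ i ]%= not

Adj : Vertex → Vertex → Set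
Adj u v = Σ (Fin 5) λ i → v ≡ flipAt i u

low : Vertex → Set
low x = (lookup x i4 ≡ false) × (lookup x i5 ≡ false)

-- the defining clauses of E(G), as (possibly one-directional) pairs
data GEdge₀ : Vertex → Vertex → Set where
  c1  : ∀ u v → Adj u v → low u → low v →
        ¬ ((lookup u i2 ≡ false) × (lookup v i2 ≡ false)) → GEdge₀ u v
  c2a : GEdge₀ (false ∷ true ∷ false ∷ true ∷ false ∷ []) (false ∷ true ∷ true ∷ true ∷ false ∷ [])
  c2b : GEdge₀ (true ∷ true ∷ false ∷ true ∷ false ∷ []) (true ∷ true ∷ true ∷ true ∷ false ∷ [])
  c3a : GEdge₀ (false ∷ true ∷ true ∷ false ∷ true ∷ []) (true ∷ true ∷ true ∷ false ∷ true ∷ [])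
  c3b : GEdge₀ (false ∷ true ∷ false ∷ false ∷ true ∷ []) (true ∷ true ∷ false ∷ false ∷ true ∷ [])
  c4  : ∀ x → lookup x i2 ≡ true → low x → GEdge₀ x (flipAt i4 x)
  c5  : ∀ x → lookup x i2 ≡ true → low x → GEdge₀ x (flipAt i5 x)

GEdge : Vertex → Vertex → Set
GEdge u v = GEdge₀ u v ⊎ GEdge₀ v u

GVertex : Vertex → Set
GVertex u = ∃ λ v → GEdge u v

record Embedding : Set where
  field
    map  : Vertex → Vertex
    inj  : ∀ a b → GVertex a → GVertex b → map a ≡ map b → a ≡ b
    pres : ∀ a b → GEdge a b → Adj (map a) (map b)

InImage : Embedding → Vertex → Vertex → Set
InImage θ u v = Σ Vertex λ a → Σ Vertex λ b →
  GEdge a b × (Embedding.map θ a ≡ u) × (Embedding.map θ b ≡ v)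

GDividesQ5 : Set
GDividesQ5 = Σ ℕ λ r → Σ (Fin r → Embedding) λ θ →
  (∀ u v → Adj u v → ∃ λ k → InImage (θ k) u v) ×
  (∀ j k → ¬ (j ≡ k) → ∀ u v → InImage (θ j) u v → InImage (θ k) u v → Data.Empty.⊥)
  where import Data.Empty

record Aut : Set where
  field
    fun     : Vertex → Vertex
    inv     : Vertex → Vertex
    inv-l   : ∀ x → inv (fun x) ≡ x
    inv-r   : ∀ x → fun (inv x) ≡ x
    adj     : ∀ u v → Adj u v → Adj (fun u) (fun v)
    adj-inv : ∀ u v → Adj (fun u) (fun v) → Adj u v

-- a subgroup of Aut(Q₅), given by a membership predicate closed under the
-- group operations (elements determined up to their action on vertices)
record IsSubgroup (Γ : Aut → Set) : Set₁ where
  field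
    has-id  : ∃ λ γ → Γ γ × (∀ x → Aut.fun γ x ≡ x)
    has-comp : ∀ γ δ → Γ γ → Γ δ → ∃ λ ε → Γ ε × (∀ x → Aut.fun ε x ≡ Aut.fun γ (Aut.fun δ x))
    has-inv : ∀ γ → Γ γ → ∃ λ ε → Γ ε × (∀ x → Aut.fun ε x ≡ Aut.inv γ x)

InTranslate : Aut → Vertex → Vertex → Set
InTranslate γ u v = GEdge (Aut.inv γ u) (Aut.inv γ v)

Fundamental : Set₁
Fundamental = Σ (Aut → Set) λ Γ → IsSubgroup Γ ×
  (∀ u v → Adj u v → ∃ λ γ → Γ γ × InTranslate γ u v) ×
  (∀ γ δ → Γ γ → Γ δ →
     (∃ λ u → ∃ λ v → InTranslate γ u v × InTranslate δ u v) →
     ∀ u v → InTranslate γ u v → InTranslate δ u v)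

module Submission where

-- Let σ be the automorphism of Q₅
--   σ(x₁x₂x₃x₄x₅) = x₁ x̄₂ x₃ x₅ x̄₄,
-- which has order 4, and let Γ = {σᵏ : k < 4} be the cyclic subgroup it
-- generates.  Since |E(Q₅)| = 80 = 4 · |E(G)|, it suffices to check that
-- every edge of Q₅ lies in some translate σᵏ(E(G)) and in no two distinct
-- ones; then {σᵏ(E(G))} partitions E(Q₅), so E(G) is a fundamental set, and
-- the four embeddings σᵏ of G show that G divides Q₅.

open import Defs
open import Data.Bool using (Bool; true; false; not)
import Data.Bool as Bool
open import Data.Bool.Properties using (not-involutive)
open import Data.Empty using (⊥)
open import Data.Fin using (Fin; zero; suc; toℕ)
open import Data.Fin.Properties using (all?; any?)
import Data.Fin as Fin
open import Data.Nat using (ℕ)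
open import Data.Nat.GeneralisedArithmetic using (iterate)
open import Data.Product using (Σ; ∃; _×_; _,_; proj₁; proj₂)
open import Data.Sum using (_⊎_; inj₁; inj₂)
open import Data.Vec using (Vec; []; _∷_; lookup; _[_]%=_)
open import Data.Vec.Properties using (≡-dec; []%=-∘; []%=-id; updateAt-cong)
open import Function using (id; _∘_)
open import Relation.Nullary using (¬_; Dec)
open import Relation.Nullary.Decidable using (map′; toWitness; ¬?; _×-dec_; _⊎-dec_; _→-dec_)
open import Relation.Binary.PropositionalEquality
open ≡-Reasoning

∀-cube? : ∀ {n p} {P : Vec Bool n → Set p} →
          (∀ x → Dec (P x)) → Dec (∀ x → P x)
∀-cube? {ℕ.zero} P? = map′ (λ { p [] → p }) (λ h → h []) (P? [])
∀-cube? {ℕ.suc n} P? =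
  map′ (λ { (p , q) (true ∷ x) → p x ; (p , q) (false ∷ x) → q x })
       (λ h → (λ x → h (true ∷ x)) , (λ x → h (false ∷ x)))
       (∀-cube? (λ x → P? (true ∷ x)) ×-dec ∀-cube? (λ x → P? (false ∷ x)))

_≟ᵥ_ : (u v : Vertex) → Dec (u ≡ v)
_≟ᵥ_ = ≡-dec Bool._≟_

adj? : ∀ u v → Dec (Adj u v)
adj? u v = any? (λ i → v ≟ᵥ flipAt i u)

flip-involutive : ∀ i x → flipAt i (flipAt i x) ≡ x
flip-involutive i x = begin
  flipAt i (flipAt i x)  ≡⟨ []%=-∘ x i ⟩
  x [ i ]%= (not ∘ not)  ≡⟨ updateAt-cong i not-involutive x ⟩
  x [ i ]%= id           ≡⟨ []%=-id x i ⟩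
  x                      ∎

adj-sym : ∀ u v → Adj u v → Adj v u
adj-sym u v (i , refl) = i , sym (flip-involutive i u)

vertex₀₁₀₁₀ vertex₀₁₁₁₀ vertex₁₁₀₁₀ vertex₁₁₁₁₀ : Vertex
vertex₀₁₁₀₁ vertex₁₁₁₀₁ vertex₀₁₀₀₁ vertex₁₁₀₀₁ : Vertex
vertex₀₁₀₁₀ = false ∷ true ∷ false ∷ true ∷ false ∷ []
vertex₀₁₁₁₀ = false ∷ true ∷ true ∷ true ∷ false ∷ []
vertex₁₁₀₁₀ = true ∷ true ∷ false ∷ true ∷ false ∷ []
vertex₁₁₁₁₀ = true ∷ true ∷ true ∷ true ∷ false ∷ []
vertex₀₁₁₀₁ = false ∷ true ∷ true ∷ false ∷ true ∷ []
vertex₁₁₁₀₁ = true ∷ true ∷ true ∷ false ∷ true ∷ []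
vertex₀₁₀₀₁ = false ∷ true ∷ false ∷ false ∷ true ∷ []
vertex₁₁₀₀₁ = true ∷ true ∷ false ∷ false ∷ true ∷ []

LowEdge : Vertex → Vertex → Set
LowEdge u v = Adj u v × low u × low v ×
              ¬ ((lookup u i2 ≡ false) × (lookup v i2 ≡ false))

IsEdge : Vertex → Vertex → Vertex → Vertex → Set
IsEdge a b u v = (u ≡ a) × (v ≡ b)

Spoke : Fin 5 → Vertex → Vertex → Set
Spoke i u v = (lookup u i2 ≡ true) × low u × (v ≡ flipAt i u)

-- The seven defining clauses of E(G), each built from decidable pieces; the
-- two translations below show this is just GEdge₀ in decidable form.
GClauses : Vertex → Vertex → Set
GClauses u v =
  LowEdge u v ⊎ IsEdge vertex₀₁₀₁₀ vertex₀₁₁₁₀ u v ⊎ IsEdge vertex₁₁₀₁₀ vertex₁₁₁₁₀ u v ⊎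
  IsEdge vertex₀₁₁₀₁ vertex₁₁₁₀₁ u v ⊎ IsEdge vertex₀₁₀₀₁ vertex₁₁₀₀₁ u v ⊎
  Spoke i4 u v ⊎ Spoke i5 u v

GEdge₀⇒clauses : ∀ {u v} → GEdge₀ u v → GClauses u v
GEdge₀⇒clauses (c1 u v a lu lv n) = inj₁ (a , lu , lv , n)
GEdge₀⇒clauses c2a                = inj₂ (inj₁ (refl , refl))
GEdge₀⇒clauses c2b                = inj₂ (inj₂ (inj₁ (refl , refl)))
GEdge₀⇒clauses c3a                = inj₂ (inj₂ (inj₂ (inj₁ (refl , refl))))
GEdge₀⇒clauses c3b                = inj₂ (inj₂ (inj₂ (inj₂ (inj₁ (refl , refl)))))
GEdge₀⇒clauses (c4 x p l)         = inj₂ (inj₂ (inj₂ (inj₂ (inj₂ (inj₁ (p , l , refl))))))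
GEdge₀⇒clauses (c5 x p l)         = inj₂ (inj₂ (inj₂ (inj₂ (inj₂ (inj₂ (p , l , refl))))))

clauses⇒GEdge₀ : ∀ {u v} → GClauses u v → GEdge₀ u v
clauses⇒GEdge₀ {u} {v} (inj₁ (a , lu , lv , n))                             = c1 u v a lu lv n
clauses⇒GEdge₀ (inj₂ (inj₁ (refl , refl)))                                  = c2a
clauses⇒GEdge₀ (inj₂ (inj₂ (inj₁ (refl , refl))))                           = c2b
clauses⇒GEdge₀ (inj₂ (inj₂ (inj₂ (inj₁ (refl , refl)))))                    = c3a
clauses⇒GEdge₀ (inj₂ (inj₂ (inj₂ (inj₂ (inj₁ (refl , refl))))))             = c3b
clauses⇒GEdge₀ {u} (inj₂ (inj₂ (inj₂ (inj₂ (inj₂ (inj₁ (p , l , refl))))))) = c4 u p l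
clauses⇒GEdge₀ {u} (inj₂ (inj₂ (inj₂ (inj₂ (inj₂ (inj₂ (p , l , refl))))))) = c5 u p l

gedge? : ∀ u v → Dec (GEdge u v)
gedge? u v = gedge₀? u v ⊎-dec gedge₀? v u
  where
  low? : ∀ x → Dec (low x)
  low? x = (lookup x i4 Bool.≟ false) ×-dec (lookup x i5 Bool.≟ false)

  isEdge? : ∀ a b x y → Dec (IsEdge a b x y)
  isEdge? a b x y = (x ≟ᵥ a) ×-dec (y ≟ᵥ b)

  spoke? : ∀ i x y → Dec (Spoke i x y)
  spoke? i x y = (lookup x i2 Bool.≟ true) ×-dec low? x ×-dec (y ≟ᵥ flipAt i x)

  gedge₀? : ∀ x y → Dec (GEdge₀ x y)
  gedge₀? x y = map′ clauses⇒GEdge₀ GEdge₀⇒clauses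
    ((adj? x y ×-dec low? x ×-dec low? y ×-dec
       ¬? ((lookup x i2 Bool.≟ false) ×-dec (lookup y i2 Bool.≟ false)))
     ⊎-dec isEdge? vertex₀₁₀₁₀ vertex₀₁₁₁₀ x y ⊎-dec isEdge? vertex₁₁₀₁₀ vertex₁₁₁₁₀ x y
     ⊎-dec isEdge? vertex₀₁₁₀₁ vertex₁₁₁₀₁ x y ⊎-dec isEdge? vertex₀₁₀₀₁ vertex₁₁₀₀₁ x y
     ⊎-dec spoke? i4 x y ⊎-dec spoke? i5 x y)

gedge₀-adj : ∀ u v → GEdge₀ u v → Adj u v
gedge₀-adj u v (c1 .u .v a _ _ _) = a
gedge₀-adj _ _ c2a                = i3 , refl
gedge₀-adj _ _ c2b                = i3 , refl
gedge₀-adj _ _ c3a                = i1 , refl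
gedge₀-adj _ _ c3b                = i1 , refl
gedge₀-adj u _ (c4 .u _ _)        = i4 , refl
gedge₀-adj u _ (c5 .u _ _)        = i5 , refl

gedge-adj : ∀ u v → GEdge u v → Adj u v
gedge-adj u v (inj₁ e) = gedge₀-adj u v e
gedge-adj u v (inj₂ e) = adj-sym v u (gedge₀-adj v u e)

PreservesAdj : (Vertex → Vertex) → Set
PreservesAdj f = ∀ u v → Adj u v → Adj (f u) (f v)

iterate-preservesAdj : ∀ {f} → PreservesAdj f → ∀ n → PreservesAdj (λ x → iterate f x n)
iterate-preservesAdj p ℕ.zero    u v a = a
iterate-preservesAdj p (ℕ.suc n) u v a = iterate-preservesAdj p n _ _ (p u v a)

mkAut : (f f⁻¹ : Vertex → Vertex) → (∀ x → f⁻¹ (f x) ≡ x) → (∀ x → f (f⁻¹ x) ≡ x) →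
        PreservesAdj f → PreservesAdj f⁻¹ → Aut
mkAut f f⁻¹ left right pres pres⁻¹ = record
  { fun = f ; inv = f⁻¹ ; inv-l = left ; inv-r = right ; adj = pres
  ; adj-inv = λ u v a → subst₂ Adj (left u) (left v) (pres⁻¹ _ _ a) }

σ : Vertex → Vertex
σ (a ∷ b ∷ c ∷ d ∷ e ∷ []) = a ∷ not b ∷ c ∷ e ∷ not d ∷ []

rot : Fin 4 → Vertex → Vertex
rot k x = iterate σ x (toℕ k)

-- σ⁻ᵏ = σ⁴⁻ᵏ.
inverse : Fin 4 → Fin 4
inverse zero                   = zero
inverse (suc zero)             = suc (suc (suc zero))
inverse (suc (suc zero))       = suc (suc zero)
inverse (suc (suc (suc zero))) = suc zero

σ-preservesAdj : PreservesAdj σ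
σ-preservesAdj u v (i , refl) = toWitness {a? = check} _ u i
  where check = ∀-cube? λ x → all? λ j → adj? (σ x) (σ (flipAt j x))

rot-preservesAdj : ∀ k → PreservesAdj (rot k)
rot-preservesAdj k = iterate-preservesAdj σ-preservesAdj (toℕ k)

rot-inverse-left : ∀ k x → rot (inverse k) (rot k x) ≡ x
rot-inverse-left = toWitness {a? = all? λ k → ∀-cube? λ x → rot (inverse k) (rot k x) ≟ᵥ x} _

rot-inverse-right : ∀ k x → rot k (rot (inverse k) x) ≡ x
rot-inverse-right = toWitness {a? = all? λ k → ∀-cube? λ x → rot k (rot (inverse k) x) ≟ᵥ x} _

-- {σᵏ} is closed under composition (as σ⁴ = id).
rot-closed : ∀ k l → Σ (Fin 4) λ m → ∀ x → rot m x ≡ rot k (rot l x)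
rot-closed = toWitness {a? = all? λ k → all? λ l → any? λ m →
                                 ∀-cube? λ x → rot m x ≟ᵥ rot k (rot l x)} _

rotAut : Fin 4 → Aut
rotAut k = mkAut (rot k) (rot (inverse k)) (rot-inverse-left k) (rot-inverse-right k)
                 (rot-preservesAdj k) (rot-preservesAdj (inverse k))

Translate : Fin 4 → Vertex → Vertex → Set
Translate k u v = GEdge (rot (inverse k) u) (rot (inverse k) v)

translate-adj : ∀ k u v → Translate k u v → Adj u v
translate-adj k u v e =
  subst₂ Adj (rot-inverse-right k u) (rot-inverse-right k v)
    (rot-preservesAdj k _ _ (gedge-adj _ _ e))

translates-cover : ∀ u v → Adj u v → ∃ λ k → Translate k u v
translates-cover u v (i , refl) = toWitness {a? = check} _ u i
  where check = ∀-cube? λ x → all? λ j → any? λ k →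
                  gedge? (rot (inverse k) x) (rot (inverse k) (flipAt j x))

translates-disjoint : ∀ k l u v → Translate k u v → Translate l u v → k ≡ l
translates-disjoint k l u v e with translate-adj k u v e
... | i , refl = toWitness {a? = check} _ k l u i e
  where check = all? λ k → all? λ l → ∀-cube? λ x → all? λ j →
                  gedge? (rot (inverse k) x) (rot (inverse k) (flipAt j x)) →-dec
                  (gedge? (rot (inverse l) x) (rot (inverse l) (flipAt j x)) →-dec (k Fin.≟ l))

rotEmbedding : Fin 4 → Embedding
rotEmbedding k = record
  { map  = rot k
  ; inj  = λ a b _ _ eq → begin
      a                            ≡⟨ sym (rot-inverse-left k a) ⟩
      rot (inverse k) (rot k a)    ≡⟨ cong (rot (inverse k)) eq ⟩
      rot (inverse k) (rot k b)    ≡⟨ rot-inverse-left k b ⟩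
      b                            ∎
  ; pres = λ a b e → rot-preservesAdj k a b (gedge-adj a b e) }

image⇒translate : ∀ k u v → InImage (rotEmbedding k) u v → Translate k u v
image⇒translate k _ _ (a , b , e , refl , refl) =
  subst₂ GEdge (sym (rot-inverse-left k a)) (sym (rot-inverse-left k b)) e

translate⇒image : ∀ k u v → Translate k u v → InImage (rotEmbedding k) u v
translate⇒image k u v e = _ , _ , e , rot-inverse-right k u , rot-inverse-right k v

divides : GDividesQ5
divides = 4 , rotEmbedding , cover , disjoint
  where
  cover : ∀ u v → Adj u v → ∃ λ k → InImage (rotEmbedding k) u v
  cover u v a with translates-cover u v a
  ... | k , e = k , translate⇒image k u v e

  disjoint : ∀ j k → ¬ (j ≡ k) → ∀ u v →
             InImage (rotEmbedding j) u v → InImage (rotEmbedding k) u v → ⊥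
  disjoint j k j≢k u v p q =
    j≢k (translates-disjoint j k u v (image⇒translate j u v p) (image⇒translate k u v q))

Γ : Aut → Set
Γ γ = Σ (Fin 4) λ k → ∀ x → Aut.fun γ x ≡ rot k x

Γ-inv : ∀ γ k → (∀ x → Aut.fun γ x ≡ rot k x) → ∀ x → Aut.inv γ x ≡ rot (inverse k) x
Γ-inv γ k fun≗rot x = begin
  Aut.inv γ x                                 ≡⟨ cong (Aut.inv γ) (sym (rot-inverse-right k x)) ⟩
  Aut.inv γ (rot k (rot (inverse k) x))       ≡⟨ cong (Aut.inv γ) (sym (fun≗rot _)) ⟩
  Aut.inv γ (Aut.fun γ (rot (inverse k) x))   ≡⟨ Aut.inv-l γ _ ⟩
  rot (inverse k) x                           ∎

Γ-subgroup : IsSubgroup Γ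
Γ-subgroup = record
  { has-id   = rotAut zero , (zero , λ _ → refl) , λ _ → refl
  ; has-comp = λ { γ δ (k , γ≗) (l , δ≗) → let (m , m≗) = rot-closed k l in
      rotAut m , (m , λ _ → refl) ,
      λ x → trans (m≗ x) (trans (cong (rot k) (sym (δ≗ x))) (sym (γ≗ _))) }
  ; has-inv  = λ { γ (k , γ≗) → rotAut (inverse k) , (inverse k , λ _ → refl) ,
      λ x → sym (Γ-inv γ k γ≗ x) } }

inTranslate⇔ : ∀ γ k → (∀ x → Aut.fun γ x ≡ rot k x) → ∀ u v →
               (InTranslate γ u v → Translate k u v) × (Translate k u v → InTranslate γ u v)
inTranslate⇔ γ k γ≗ u v =
  subst₂ GEdge (Γ-inv γ k γ≗ u) (Γ-inv γ k γ≗ v) ,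
  subst₂ GEdge (sym (Γ-inv γ k γ≗ u)) (sym (Γ-inv γ k γ≗ v))

fundamental : Fundamental
fundamental = Γ , Γ-subgroup , cover , sharedEdge⇒same
  where
  cover : ∀ u v → Adj u v → ∃ λ γ → Γ γ × InTranslate γ u v
  cover u v a with translates-cover u v a
  ... | k , e = rotAut k , (k , λ _ → refl) , e

  sharedEdge⇒same : ∀ γ δ → Γ γ → Γ δ →
                    (∃ λ u → ∃ λ v → InTranslate γ u v × InTranslate δ u v) →
                    ∀ u v → InTranslate γ u v → InTranslate δ u v
  sharedEdge⇒same γ δ (k , γ≗) (l , δ≗) (u₀ , v₀ , p , q) u v e
    with translates-disjoint k l u₀ v₀ (proj₁ (inTranslate⇔ γ k γ≗ u₀ v₀) p)
                                       (proj₁ (inTranslate⇔ δ l δ≗ u₀ v₀) q)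
  ... | refl = proj₂ (inTranslate⇔ δ k δ≗ u v) (proj₁ (inTranslate⇔ γ k γ≗ u v) e)

lemma4 : GDividesQ5 × Fundamental
lemma4 = divides , fundamental
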